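{- Let $\mathcal{B}$ be a covariant fibration of reflexive graphs over a reflexive graph $\mathcal{A}$. For all $p:x\approx_{\mathcal{A}}y$, $u:|\mathcal{B}|(x)$ and $v:|\mathcal{B}|(y)$, the straightening function $\mathsf{str}_p:(u\approx^{\mathcal{B}}_pv)\to(p_*u\approx_{\mathcal{B}(y)}v)$ is an equivalence, with inverse given by the unstraightening function $\mathsf{unstr}_p:(p_*u\approx_{\mathcal{B}(y)}v)\to(u\approx^{\mathcal{B}}_pv)$.
   Context: Intensional Martin-Löf type theory with $\Pi,\Sigma$, identity types. A reflexive graph $\mathcal{A}$: type $|\mathcal{A}|$, edge types $x\approx_{\mathcal{A}}y$, $\mathsf{rx}_{\mathcal{A}}(x)$. A displayed reflexive graph $\mathcal{B}$ over $\mathcal{A}$: types $|\mathcal{B}|(x)$, types $u\approx^{\mathcal{B}}_pv$ for $p:x\approx_{\mathcal{A}}y$, $u:|\mathcal{B}|(x)$, $v:|\mathcal{B}|(y)$, and $\mathsf{rx}^{\mathcal{B}}_x(u):u\approx^{\mathcal{B}}_{\mathsf{rx}_{\mathcal{A}}(x)}u$. Its component $\mathcal{B}(y)$ has vertices $|\mathcal{B}|(y)$, edges $w\approx_{\mathcal{B}(y)}w':=w\approx^{\mathcal{B}}_{\mathsf{rx}_{\mathcal{A}}(y)}w'$. $\mathcal{B}$ is a covariant fibration if each $\sum_{v:|\mathcal{B}|(y)}u\approx^{\mathcal{B}}_pv$ is contractible; write $(p_*u,p_\dagger u)$ for its centre. Such a $\mathcal{B}$ has univalent components, so each $\sum_{w}p_*u\approx_{\mathcal{B}(y)}w$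 is contractible too. Straightening: for $q:u\approx^{\mathcal{B}}_pv$, choose $H:(p_*u,p_\dagger u)=(v,q)$ in $\sum_wu\approx^{\mathcal{B}}_pw$ and set $\mathsf{str}_p(q):=$ the transport of $\mathsf{rx}^{\mathcal{B}}_y(p_*u)$ along $H$ in the family $(w,r)\mapsto p_*u\approx_{\mathcal{B}(y)}w$. Unstraightening: for $q:p_*u\approx_{\mathcal{B}(y)}v$, choose $H:(p_*u,\mathsf{rx}^{\mathcal{B}}_y(p_*u))=(v,q)$ in $\sum_wp_*u\approx_{\mathcal{B}(y)}w$ and set $\mathsf{unstr}_p(q):=$ the transport of $p_\dagger u$ along $H$ in the family $(w,r)\mapsto u\approx^{\mathcal{B}}_pw$. -}

{-# OPTIONS --without-K #-}
module Defs where

open import Level using (Level; _⊔_; suc)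
open import Data.Product using (Σ; _,_; proj₁; proj₂; _×_)
open import Relation.Binary.PropositionalEquality using (_≡_; refl; sym; trans; subst)

isContr : ∀ {ℓ} → Set ℓ → Set ℓ
isContr A = Σ A λ c → (x : A) → c ≡ x

contr-path : ∀ {ℓ} {A : Set ℓ} → isContr A → (a b : A) → a ≡ b
contr-path (c , h) a b = trans (sym (h a)) (h b)

fiber : ∀ {ℓ ℓ'} {A : Set ℓ} {B : Set ℓ'} → (A → B) → B → Set (ℓ ⊔ ℓ')
fiber {A = A} f b = Σ A λ a → f a ≡ b

isEquiv : ∀ {ℓ ℓ'} {A : Set ℓ} {B : Set ℓ'} → (A → B) → Set (ℓ ⊔ ℓ')
isEquiv {B = B} f = (b : B) → isContr (fiber f b)

record RefGraph (ℓ₀ ℓ₁ : Level) : Set (suc (ℓ₀ ⊔ ℓ₁)) where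
  field
    ∣_∣  : Set ℓ₀
    _≈_ : ∣_∣ → ∣_∣ → Set ℓ₁
    rx  : (x : ∣_∣) → x ≈ x

record DispRefGraph {ℓ₀ ℓ₁ : Level} (𝒜 : RefGraph ℓ₀ ℓ₁) (ℓ₂ ℓ₃ : Level)
       : Set (ℓ₀ ⊔ ℓ₁ ⊔ suc (ℓ₂ ⊔ ℓ₃)) where
  open RefGraph 𝒜 renaming (∣_∣ to A; _≈_ to _≈A_; rx to rxA)
  field
    ∣_∣ᴰ : A → Set ℓ₂
    Edge : {x y : A} → x ≈A y → ∣_∣ᴰ x → ∣_∣ᴰ y → Set ℓ₃
    rxᴰ  : (x : A) (u : ∣_∣ᴰ x) → Edge (rxA x) u u

  CompEdge : (y : A) → ∣_∣ᴰ y → ∣_∣ᴰ y → Set ℓ₃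
  CompEdge y w w' = Edge (rxA y) w w'

isCovFib : ∀ {ℓ₀ ℓ₁ ℓ₂ ℓ₃} {𝒜 : RefGraph ℓ₀ ℓ₁} → DispRefGraph 𝒜 ℓ₂ ℓ₃ → Set (ℓ₀ ⊔ ℓ₁ ⊔ ℓ₂ ⊔ ℓ₃)
isCovFib {𝒜 = 𝒜} ℬ =
  {x y : ∣_∣} (p : x ≈ y) (u : ∣_∣ᴰ x) → isContr (Σ (∣_∣ᴰ y) λ v → Edge p u v)
  where open RefGraph 𝒜
        open DispRefGraph ℬ

module CovFib {ℓ₀ ℓ₁ ℓ₂ ℓ₃} {𝒜 : RefGraph ℓ₀ ℓ₁} (ℬ : DispRefGraph 𝒜 ℓ₂ ℓ₃)
              (fib : isCovFib ℬ) where
  open RefGraph 𝒜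
  open DispRefGraph ℬ

  push : {x y : ∣_∣} (p : x ≈ y) → ∣_∣ᴰ x → ∣_∣ᴰ y
  push p u = proj₁ (proj₁ (fib p u))

  lift : {x y : ∣_∣} (p : x ≈ y) (u : ∣_∣ᴰ x) → Edge p u (push p u)
  lift p u = proj₂ (proj₁ (fib p u))

  compContr : {y : ∣_∣} (w₀ : ∣_∣ᴰ y) → isContr (Σ (∣_∣ᴰ y) λ w → CompEdge y w₀ w)
  compContr {y} w₀ = fib (rx y) w₀

  str : {x y : ∣_∣} (p : x ≈ y) (u : ∣_∣ᴰ x) (v : ∣_∣ᴰ y)
      → Edge p u v → CompEdge y (push p u) v
  str {y = y} p u v q =
    subst (λ (z : Σ (∣_∣ᴰ y) λ w → Edge p u w) → CompEdge y (push p u) (proj₁ z))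
          (contr-path (fib p u) (push p u , lift p u) (v , q))
          (rxᴰ y (push p u))

  unstr : {x y : ∣_∣} (p : x ≈ y) (u : ∣_∣ᴰ x) (v : ∣_∣ᴰ y)
        → CompEdge y (push p u) v → Edge p u v
  unstr {y = y} p u v q =
    subst (λ (z : Σ (∣_∣ᴰ y) λ w → CompEdge y (push p u) w) → Edge p u (proj₁ z))
          (contr-path (compContr (push p u)) (push p u , rxᴰ y (push p u)) (v , q))
          (lift p u)

-- Both str_p and unstr_p are instances of one construction: given type families E and F
-- over A with contractible total spaces and points e : E a, f : F a, transport f along
-- the contraction of Σ A E.  Transferring e → f and then back is the identity, because
-- transport along any path (a , e) ≡ (v , q) may be used, and J reduces the claim to the
-- contraction path of (a , f) to itself, which is refl.
module Submission where

open import Defs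
open import Level using (Level)
open import Data.Product using (Σ; _,_; proj₁; proj₂; _×_)
open import Function.Base using (_∘_)
open import Function.Bundles using (mk↔ₛ′)
open import Function.Properties.Inverse.HalfAdjointEquivalence using (_≃_; ↔⇒≃)
open import Relation.Binary.PropositionalEquality
  using (_≡_; refl; cong; subst; trans-symˡ)

private
  variable
    ℓ ℓ' ℓ'' : Level

contr-path-refl : {A : Set ℓ} (C : isContr A) (a : A) → contr-path C a a ≡ refl
contr-path-refl (c , h) a = trans-symˡ (h a)

≃⇒isEquiv : {A : Set ℓ} {B : Set ℓ'} (e : A ≃ B) → isEquiv (_≃_.to e)
≃⇒isEquiv {A = A} {B} e b = (from b , right-inverse-of b) , λ { (a , fa≡b) → centre≡ a fa≡b }
  where
  open _≃_ e
  centre≡ : (a : A) {b : B} (fa≡b : to a ≡ b)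
          → _≡_ {A = fiber to b} (from b , right-inverse-of b) (a , fa≡b)
  centre≡ a refl = fiber-path (left-inverse-of a) (right-inverse-of (to a)) (left-right a)
    where
    fiber-path : {a' : A} (h : a' ≡ a) (k : to a' ≡ to a) → cong to h ≡ k
               → _≡_ {A = fiber to (to a)} (a' , k) (a , refl)
    fiber-path refl k refl = refl

inverses⇒isEquiv : {A : Set ℓ} {B : Set ℓ'} (f : A → B) (g : B → A)
                 → (∀ b → f (g b) ≡ b) → (∀ a → g (f a) ≡ a) → isEquiv f
inverses⇒isEquiv f g f∘g g∘f = ≃⇒isEquiv (↔⇒≃ (mk↔ₛ′ f g f∘g g∘f))

transfer : {A : Set ℓ} (E : A → Set ℓ') (F : A → Set ℓ'') {a : A}
         → E a → F a → isContr (Σ A E) → (v : A) → E v → F v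
transfer E F {a} e f CE v q = subst (F ∘ proj₁) (contr-path CE (a , e) (v , q)) f

transfer-along : {A : Set ℓ} (E : A → Set ℓ') (F : A → Set ℓ'') {a : A} (e : E a) (f : F a)
               (CF : isContr (Σ A F)) (z : Σ A E) (P : (a , e) ≡ z)
               → transfer F E f e CF (proj₁ z) (subst (F ∘ proj₁) P f) ≡ proj₂ z
transfer-along E F {a} e f CF _ refl =
  cong (λ P → subst (E ∘ proj₁) P e) (contr-path-refl CF (a , f))

transfer-inverse : {A : Set ℓ} (E : A → Set ℓ') (F : A → Set ℓ'') {a : A} (e : E a) (f : F a)
                 (CE : isContr (Σ A E)) (CF : isContr (Σ A F))
                 → (v : A) (q : E v) → transfer F E f e CF v (transfer E F e f CE v q) ≡ q
transfer-inverse E F e f CE CF v q = transfer-along E F e f CF (v , q) (contr-path CE _ _)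

mainTheorem12 : ∀ {ℓ₀ ℓ₁ ℓ₂ ℓ₃} {𝒜 : RefGraph ℓ₀ ℓ₁} (ℬ : DispRefGraph 𝒜 ℓ₂ ℓ₃) (fib : isCovFib ℬ)
    → ∀ {x y} (p : RefGraph._≈_ 𝒜 x y) (u : DispRefGraph.∣_∣ᴰ ℬ x) (v : DispRefGraph.∣_∣ᴰ ℬ y)
    → isEquiv (CovFib.str ℬ fib p u v)
      × (∀ q → CovFib.str ℬ fib p u v (CovFib.unstr ℬ fib p u v q) ≡ q)
      × (∀ q → CovFib.unstr ℬ fib p u v (CovFib.str ℬ fib p u v q) ≡ q)
mainTheorem12 {𝒜 = 𝒜} ℬ fib {y = y} p u v =
  inverses⇒isEquiv (str p u v) (unstr p u v) str∘unstr unstr∘str , str∘unstr , unstr∘str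
  where
  open RefGraph 𝒜
  open DispRefGraph ℬ
  open CovFib ℬ fib

  unstr∘str : ∀ q → unstr p u v (str p u v q) ≡ q
  unstr∘str = transfer-inverse (Edge p u) (CompEdge y (push p u))
    (lift p u) (rxᴰ y (push p u)) (fib p u) (compContr (push p u)) v

  str∘unstr : ∀ q → str p u v (unstr p u v q) ≡ q
  str∘unstr = transfer-inverse (CompEdge y (push p u)) (Edge p u)
    (rxᴰ y (push p u)) (lift p u) (compContr (push p u)) (fib p u) v
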